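{- Let $(p,q)$ be a generalised binary quartic with $p=lx^2+mxz+nz^2$, $q=ax^4+bx^3z+cx^2z^2+dxz^3+ez^4$, with associated forms $F_2,G_2$. (i) If $(p',q')=[\mu,(r_0,r_1,r_2),I_2](p,q)$ then $F'_2(x,z)=\mu^2F_2(x,z)$ and $G'_2(x,z)=\mu^4\bigl(G_2(x,z)+(lr_2+2r_0r_2+nr_0)F_2(x,z)\bigr)$. (ii) If $(p',q')=[1,0,\begin{pmatrix}\alpha&\beta\\\gamma&\delta\end{pmatrix}](p,q)$ then $F'_2(x,z)=F_2(\alpha x+\gamma z,\beta x+\delta z)$ and $G'_2(x,z)=(\alpha\delta-\beta\gamma)^2G_2(\alpha x+\gamma z,\beta x+\delta z)-\lambda F_2(\alpha x+\gamma z,\beta x+\delta z)$, where $\lambda=2\alpha^2\gamma^2a+\alpha\gamma(\alpha\delta+\beta\gamma)b+2\alpha\beta\gamma\delta c+\beta\delta(\alpha\delta+\beta\gamma)d+2\beta^2\delta^2e$.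
   Context: A generalised binary quartic $(p,q)$ represents $y^2+p(x,z)y=q(x,z)$. $F_2=p^2+4q$ and $G_2=(-l^2c+lmb-m^2a-4ac+b^2)x^4+(-2l^2d+2lnb-4mna-8ad)x^3z+(-4l^2e-lmd+2lnc-mnb-4n^2a-16ae-2bd)x^2z^2+(-4lme+2lnd-2n^2b-8be)xz^3+(-m^2e+mnd-n^2c-4ce+d^2)z^4$; $F'_2,G'_2$ are the same forms for $(p',q')$. The transformation $[\mu,r,N]$ ($\mu$ a unit, $r=(r_0,r_1,r_2)$, $N=(n_{ij})$ invertible $2\times2$) acts by $y\leftarrow\mu^{ -1}y+r_0x^2+r_1xz+r_2z^2$ (i.e. $(p,q)\mapsto(\mu(p+2r),\mu^2(q-pr-r^2))$ with $r=r_0x^2+r_1xz+r_2z^2$), followed by the substitution $x_j\leftarrow\sum_in_{ij}x_i$ where $(x_1,x_2)=(x,z)$. -}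

module Defs where

open import Level using (Level)
open import Data.Nat using (ℕ; zero; suc; _∸_)
open import Algebra.Bundles using (CommutativeRing)
open import Data.Product using (∃)

-- Binary forms over a commutative ring R.
-- A binary form of degree k is represented by its coefficient sequence
-- f : ℕ → R, where f i is the coefficient of x^(k-i) z^i (and f i = 0 for i > k).
module Forms {c ℓ : Level} (R : CommutativeRing c ℓ) where
  open CommutativeRing R

  Form : Set c
  Form = ℕ → Carrier

  _≋_ : Form → Form → Set ℓ
  f ≋ g = ∀ i → f i ≈ g i

  #_ : ℕ → Carrier
  # zero = 0#
  # suc n = 1# + # n

  sumTo : ℕ → (ℕ → Carrier) → Carrier
  sumTo zero f = f 0
  sumTo (suc n) f = sumTo n f + f (suc n)

  _⊕_ : Form → Form → Form
  (f ⊕ g) i = f i + g i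

  _⊖_ : Form → Form → Form
  (f ⊖ g) i = f i - g i

  _·_ : Carrier → Form → Form
  (s · f) i = s * f i

  _⊗_ : Form → Form → Form
  (f ⊗ g) i = sumTo i (λ j → f j * g (i ∸ j))

  oneF : Form
  oneF zero = 1#
  oneF (suc _) = 0#

  _^F_ : Form → ℕ → Form
  f ^F zero = oneF
  f ^F suc n = f ⊗ (f ^F n)

  lin : Carrier → Carrier → Form
  lin u v zero = u
  lin u v (suc zero) = v
  lin u v (suc (suc _)) = 0#

  quad : Carrier → Carrier → Carrier → Form
  quad l m n zero = l
  quad l m n (suc zero) = m
  quad l m n (suc (suc zero)) = n
  quad l m n (suc (suc (suc _))) = 0#

  quart : Carrier → Carrier → Carrier → Carrier → Carrier → Form
  quart a b c d e zero = a
  quart a b c d e (suc zero) = b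
  quart a b c d e (suc (suc zero)) = c
  quart a b c d e (suc (suc (suc zero))) = d
  quart a b c d e (suc (suc (suc (suc zero)))) = e
  quart a b c d e (suc (suc (suc (suc (suc _))))) = 0#

  substF : ℕ → Form → Form → Form → Form
  substF k f L₁ L₂ i = sumTo k (λ j → f j * ((L₁ ^F (k ∸ j)) ⊗ (L₂ ^F j)) i)

  IsUnit : Carrier → Set (c Level.⊔ ℓ)
  IsUnit u = ∃ λ v → u * v ≈ 1#

  IsInvertible2 : Carrier → Carrier → Carrier → Carrier → Set (c Level.⊔ ℓ)
  IsInvertible2 α β γ δ = ∃ λ α' → ∃ λ β' → ∃ λ γ' → ∃ λ δ' →
    (α * α' + β * γ' ≈ 1#) Data.Product.× (α * β' + β * δ' ≈ 0#) Data.Product.×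
    (γ * α' + δ * γ' ≈ 0#) Data.Product.× (γ * β' + δ * δ' ≈ 1#) Data.Product.×
    (α' * α + β' * γ ≈ 1#) Data.Product.× (α' * β + β' * δ ≈ 0#) Data.Product.×
    (γ' * α + δ' * γ ≈ 0#) Data.Product.× (γ' * β + δ' * δ ≈ 1#)

  -- The transformation [μ, (r₀,r₁,r₂), (α β ; γ δ)]:
  --   (p,q) ↦ (μ(p+2r), μ²(q - p r - r²)),  r = r₀x²+r₁xz+r₂z²,
  -- followed by x ← αx + γz, z ← βx + δz.
  actP : Carrier → Carrier → Carrier → Carrier →
         Carrier → Carrier → Carrier → Carrier → Form → Form → Form
  actP μ r₀ r₁ r₂ α β γ δ p q =
    substF 2 (μ · (p ⊕ ((# 2) · quad r₀ r₁ r₂))) (lin α γ) (lin β δ)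

  actQ : Carrier → Carrier → Carrier → Carrier →
         Carrier → Carrier → Carrier → Carrier → Form → Form → Form
  actQ μ r₀ r₁ r₂ α β γ δ p q =
    substF 4 ((μ * μ) · ((q ⊖ (p ⊗ r)) ⊖ (r ⊗ r))) (lin α γ) (lin β δ)
    where r = quad r₀ r₁ r₂

  F₂ : Form → Form → Form
  F₂ p q = (p ⊗ p) ⊕ ((# 4) · q)

  G₂ : Form → Form → Form
  G₂ p q = quart
    (- (l * l * c') + l * m * b - m * m * a - # 4 * a * c' + b * b)
    (- (# 2 * l * l * d) + # 2 * l * n * b - # 4 * m * n * a - # 8 * a * d)
    (- (# 4 * l * l * e) - l * m * d + # 2 * l * n * c' - m * n * b
      - # 4 * n * n * a - # 16 * a * e - # 2 * b * d)
    (- (# 4 * l * m * e) + # 2 * l * n * d - # 2 * n * n * b - # 8 * b * e)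
    (- (m * m * e) + m * n * d - n * n * c' - # 4 * c' * e + d * d)
    where
    l = p 0
    m = p 1
    n = p 2
    a = q 0
    b = q 1
    c' = q 2
    d = q 3
    e = q 4

module Submission where

open import Defs
open import Level using (Level)
open import Algebra.Bundles using (CommutativeRing)
open import Data.Product using (_×_; _,_)
open import Data.Nat as ℕ using (ℕ; zero; suc; _∸_; _≤_; _<_; z≤n; s≤s)
import Data.Nat.Properties as ℕP
open import Data.Integer as ℤ using (ℤ; +_; -[1+_])
import Data.Integer.Properties as ℤP
open import Data.Vec using (Vec; []; _∷_)
import Data.Fin as Fin
open import Data.Maybe using (just; nothing)
open import Relation.Nullary using (yes; no)
open import Relation.Binary.Definitions using (WeaklyDecidable)
import Relation.Binary.PropositionalEquality as PE
open import Algebra.Solver.Ring.AlmostCommutativeRing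
  using (fromCommutativeRing; _-Raw-AlmostCommutative⟶_; Induced-equivalence)

-- Both parts of Lemma 3.2 are polynomial identities in the twelve
-- quantities l,m,n,a,b,c,d,e and μ,r₀,r₁,r₂ (resp. α,β,γ,δ).  Each side
-- of each identity is a binary form of degree at most 4, so it suffices to
-- compare the coefficients of x⁴, x³z, …, z⁴ (module Degree).

module IntegerEmbedding {c ℓ : Level} (R : CommutativeRing c ℓ) where
  open CommutativeRing R
  open import Relation.Binary.Reasoning.Setoid setoid
  open import Algebra.Properties.Ring ring
    using (-‿involutive; -‿+-comm; -0#≈0#; -‿distribˡ-*; -‿distribʳ-*)
  open import Algebra.Properties.CommutativeSemigroup +-commutativeSemigroup using (interchange)
  open import Algebra.Properties.Semiring.Mult.TCOptimised semiring
    using (1+×; ×-homo-+; ×1-homo-*) renaming (_×_ to _×′_)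

  -- n ↦ n·1; the optimised multiple makes 0 ↦ 0# and 1 ↦ 1# hold
  -- definitionally, so constants built from 0# and 1# evaluate exactly
  ⟦_⟧ℕ : ℕ → Carrier
  ⟦ n ⟧ℕ = n ×′ 1#

  ⟦_⟧ℤ : ℤ → Carrier
  ⟦ + n ⟧ℤ = ⟦ n ⟧ℕ
  ⟦ -[1+ n ] ⟧ℤ = - ⟦ suc n ⟧ℕ

  neg-homo : ∀ i → ⟦ ℤ.- i ⟧ℤ ≈ - ⟦ i ⟧ℤ
  neg-homo (+ zero) = sym -0#≈0#
  neg-homo (+ suc n) = refl
  neg-homo -[1+ n ] = sym (-‿involutive _)

  ⊖-homo : ∀ m n → ⟦ m ℤ.⊖ n ⟧ℤ ≈ ⟦ m ⟧ℕ - ⟦ n ⟧ℕ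
  ⊖-homo zero zero = sym (trans (+-identityˡ _) -0#≈0#)
  ⊖-homo zero (suc n) = sym (+-identityˡ _)
  ⊖-homo (suc m) zero = sym (trans (+-congˡ -0#≈0#) (+-identityʳ _))
  ⊖-homo (suc m) (suc n) = begin
    ⟦ suc m ℤ.⊖ suc n ⟧ℤ              ≡⟨ PE.cong ⟦_⟧ℤ (ℤP.[1+m]⊖[1+n]≡m⊖n m n) ⟩
    ⟦ m ℤ.⊖ n ⟧ℤ                       ≈⟨ ⊖-homo m n ⟩
    ⟦ m ⟧ℕ - ⟦ n ⟧ℕ                  ≈⟨ +-identityˡ _ ⟨
    0# + (⟦ m ⟧ℕ - ⟦ n ⟧ℕ)           ≈⟨ +-congʳ (-‿inverseʳ 1#) ⟨
    (1# - 1#) + (⟦ m ⟧ℕ - ⟦ n ⟧ℕ)    ≈⟨ interchange 1# (- 1#) ⟦ m ⟧ℕ (- ⟦ n ⟧ℕ) ⟩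
    (1# + ⟦ m ⟧ℕ) + (- 1# - ⟦ n ⟧ℕ)  ≈⟨ +-congˡ (-‿+-comm 1# ⟦ n ⟧ℕ) ⟩
    (1# + ⟦ m ⟧ℕ) - (1# + ⟦ n ⟧ℕ)    ≈⟨ +-cong (1+× m 1#) (-‿cong (1+× n 1#)) ⟨
    ⟦ suc m ⟧ℕ - ⟦ suc n ⟧ℕ          ∎

  +-homo : ∀ i j → ⟦ i ℤ.+ j ⟧ℤ ≈ ⟦ i ⟧ℤ + ⟦ j ⟧ℤ
  +-homo (+ m) (+ n) = ×-homo-+ 1# m n
  +-homo (+ m) -[1+ n ] = ⊖-homo m (suc n)
  +-homo -[1+ m ] (+ n) = trans (⊖-homo n (suc m)) (+-comm _ _)
  +-homo -[1+ m ] -[1+ n ] = begin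
    - ⟦ suc (suc (m ℕ.+ n)) ⟧ℕ        ≡⟨ PE.cong (λ k → - ⟦ k ⟧ℕ) (ℕP.+-suc (suc m) n) ⟨
    - ⟦ suc m ℕ.+ suc n ⟧ℕ            ≈⟨ -‿cong (×-homo-+ 1# (suc m) (suc n)) ⟩
    - (⟦ suc m ⟧ℕ + ⟦ suc n ⟧ℕ)       ≈⟨ -‿+-comm _ _ ⟨
    - ⟦ suc m ⟧ℕ - ⟦ suc n ⟧ℕ         ∎

  *-homo-ℕ : ∀ m n → ⟦ + m ℤ.* + n ⟧ℤ ≈ ⟦ m ⟧ℕ * ⟦ n ⟧ℕ
  *-homo-ℕ m n = trans (reflexive (PE.cong ⟦_⟧ℤ (PE.sym (ℤP.pos-* m n)))) (×1-homo-* m n)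

  *-homo-negˡ : ∀ i j → ⟦ i ℤ.* j ⟧ℤ ≈ ⟦ i ⟧ℤ * ⟦ j ⟧ℤ → ⟦ ℤ.- i ℤ.* j ⟧ℤ ≈ ⟦ ℤ.- i ⟧ℤ * ⟦ j ⟧ℤ
  *-homo-negˡ i j hom = begin
    ⟦ ℤ.- i ℤ.* j ⟧ℤ      ≡⟨ PE.cong ⟦_⟧ℤ (ℤP.neg-distribˡ-* i j) ⟨
    ⟦ ℤ.- (i ℤ.* j) ⟧ℤ    ≈⟨ neg-homo (i ℤ.* j) ⟩
    - ⟦ i ℤ.* j ⟧ℤ        ≈⟨ -‿cong hom ⟩
    - (⟦ i ⟧ℤ * ⟦ j ⟧ℤ)   ≈⟨ -‿distribˡ-* _ _ ⟩
    - ⟦ i ⟧ℤ * ⟦ j ⟧ℤ     ≈⟨ *-congʳ (neg-homo i) ⟨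
    ⟦ ℤ.- i ⟧ℤ * ⟦ j ⟧ℤ   ∎

  *-homo-negʳ : ∀ i j → ⟦ i ℤ.* j ⟧ℤ ≈ ⟦ i ⟧ℤ * ⟦ j ⟧ℤ → ⟦ i ℤ.* ℤ.- j ⟧ℤ ≈ ⟦ i ⟧ℤ * ⟦ ℤ.- j ⟧ℤ
  *-homo-negʳ i j hom = begin
    ⟦ i ℤ.* ℤ.- j ⟧ℤ      ≡⟨ PE.cong ⟦_⟧ℤ (ℤP.neg-distribʳ-* i j) ⟨
    ⟦ ℤ.- (i ℤ.* j) ⟧ℤ    ≈⟨ neg-homo (i ℤ.* j) ⟩
    - ⟦ i ℤ.* j ⟧ℤ        ≈⟨ -‿cong hom ⟩
    - (⟦ i ⟧ℤ * ⟦ j ⟧ℤ)   ≈⟨ -‿distribʳ-* _ _ ⟩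
    ⟦ i ⟧ℤ * - ⟦ j ⟧ℤ     ≈⟨ *-congˡ (neg-homo j) ⟨
    ⟦ i ⟧ℤ * ⟦ ℤ.- j ⟧ℤ   ∎

  *-homo-ℕˡ : ∀ m j → ⟦ + m ℤ.* j ⟧ℤ ≈ ⟦ + m ⟧ℤ * ⟦ j ⟧ℤ
  *-homo-ℕˡ m (+ n) = *-homo-ℕ m n
  *-homo-ℕˡ m -[1+ n ] = *-homo-negʳ (+ m) (+ suc n) (*-homo-ℕ m (suc n))

  *-homo : ∀ i j → ⟦ i ℤ.* j ⟧ℤ ≈ ⟦ i ⟧ℤ * ⟦ j ⟧ℤ
  *-homo (+ m) j = *-homo-ℕˡ m j
  *-homo -[1+ m ] j = *-homo-negˡ (+ suc m) j (*-homo-ℕˡ (suc m) j)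

  morphism : ℤ.+-*-rawRing -Raw-AlmostCommutative⟶ fromCommutativeRing R
  morphism = record
    { ⟦_⟧ = ⟦_⟧ℤ ; +-homo = +-homo ; *-homo = *-homo ; -‿homo = neg-homo
    ; 0-homo = refl ; 1-homo = refl }

  -- the solver may merge integer coefficients only when they are equal
  coefficient≟ : WeaklyDecidable (Induced-equivalence morphism)
  coefficient≟ i j with i ℤ.≟ j
  ... | yes PE.refl = just refl
  ... | no _ = nothing

-- Polynomial expressions in n variables with integer coefficients, identified
-- when they agree under every valuation in R, form a commutative ring.  The
-- forms of Defs can therefore be built from expressions, and the solver
-- applies to each of their coefficients.
module Expressions {c ℓ : Level} (R : CommutativeRing c ℓ) (n : ℕ) where
  open IntegerEmbedding R using (morphism; coefficient≟)
  import Algebra.Solver.Ring ℤ.+-*-rawRing (fromCommutativeRing R) morphism coefficient≟ as Solver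
  open Solver public using (Polynomial; var; ⟦_⟧; prove)
  open Solver using (con; _:+_; _:*_; :-_)
  private module R = CommutativeRing R

  _≐_ : Polynomial n → Polynomial n → Set (c Level.⊔ ℓ)
  e ≐ f = ∀ ρ → ⟦ e ⟧ ρ R.≈ ⟦ f ⟧ ρ

  expressionRing : CommutativeRing Level.zero (c Level.⊔ ℓ)
  expressionRing = record
    { Carrier = Polynomial n ; _≈_ = _≐_ ; _+_ = _:+_ ; _*_ = _:*_ ; -_ = :-_
    ; 0# = con (+ 0) ; 1# = con (+ 1)
    ; isCommutativeRing = record
      { isRing = record
        { +-isAbelianGroup = record
          { isGroup = record
            { isMonoid = record
              { isSemigroup = record
                { isMagma = record
                  { isEquivalence = record
                    { refl = λ ρ → R.refl
                    ; sym = λ e≐f ρ → R.sym (e≐f ρ)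
                    ; trans = λ e≐f f≐g ρ → R.trans (e≐f ρ) (f≐g ρ) }
                  ; ∙-cong = λ e≐f g≐h ρ → R.+-cong (e≐f ρ) (g≐h ρ) }
                ; assoc = λ e f g ρ → R.+-assoc _ _ _ }
              ; identity = (λ e ρ → R.+-identityˡ _) , (λ e ρ → R.+-identityʳ _) }
            ; inverse = (λ e ρ → R.-‿inverseˡ _) , (λ e ρ → R.-‿inverseʳ _)
            ; ⁻¹-cong = λ e≐f ρ → R.-‿cong (e≐f ρ) }
          ; comm = λ e f ρ → R.+-comm _ _ }
        ; *-cong = λ e≐f g≐h ρ → R.*-cong (e≐f ρ) (g≐h ρ)
        ; *-assoc = λ e f g ρ → R.*-assoc _ _ _
        ; *-identity = (λ e ρ → R.*-identityˡ _) , (λ e ρ → R.*-identityʳ _)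
        ; distrib = (λ e f g ρ → R.distribˡ _ _ _) , (λ e f g ρ → R.distribʳ _ _ _) }
      ; *-comm = λ e f ρ → R.*-comm _ _ } }

module Degree {c ℓ : Level} (R : CommutativeRing c ℓ) where
  open CommutativeRing R
  open Forms R
  open import Algebra.Properties.Ring ring using (-0#≈0#)

  Deg : ℕ → Form → Set ℓ
  Deg k f = ∀ i → k < i → f i ≈ 0#

  ≋-from-low-coefficients : ∀ k {f g} → Deg k f → Deg k g →
                            (∀ i → i ≤ k → f i ≈ g i) → f ≋ g
  ≋-from-low-coefficients k Df Dg low i with i ℕP.≤? k
  ... | yes i≤k = low i i≤k
  ... | no i≰k = trans (Df i (ℕP.≰⇒> i≰k)) (sym (Dg i (ℕP.≰⇒> i≰k)))

  ≋-of-quartics : ∀ {f g} → Deg 4 f → Deg 4 g →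
                  f 0 ≈ g 0 → f 1 ≈ g 1 → f 2 ≈ g 2 → f 3 ≈ g 3 → f 4 ≈ g 4 → f ≋ g
  ≋-of-quartics {f} {g} Df Dg e₀ e₁ e₂ e₃ e₄ = ≋-from-low-coefficients 4 Df Dg low
    where
    low : ∀ i → i ≤ 4 → f i ≈ g i
    low 0 _ = e₀
    low 1 _ = e₁
    low 2 _ = e₂
    low 3 _ = e₃
    low 4 _ = e₄
    low (suc (suc (suc (suc (suc _))))) (s≤s (s≤s (s≤s (s≤s ()))))

  sumTo-zero : ∀ n h → (∀ j → j ≤ n → h j ≈ 0#) → sumTo n h ≈ 0#
  sumTo-zero zero h zeros = zeros 0 z≤n
  sumTo-zero (suc n) h zeros =
    trans (+-cong (sumTo-zero n h (λ j j≤n → zeros j (ℕP.m≤n⇒m≤1+n j≤n))) (zeros (suc n) ℕP.≤-refl))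
          (+-identityʳ 0#)

  deg-mono : ∀ {j k f} → j ≤ k → Deg j f → Deg k f
  deg-mono j≤k Df i k<i = Df i (ℕP.≤-<-trans j≤k k<i)

  -- in the i-th coefficient of f ⊗ g with i > j + k, each term f t g (i ∸ t)
  -- has t > j or i ∸ t > k
  deg-⊗ : ∀ j k {f g} → Deg j f → Deg k g → Deg (j ℕ.+ k) (f ⊗ g)
  deg-⊗ j k {f} {g} Df Dg i j+k<i = sumTo-zero i _ term-zero
    where
    term-zero : ∀ t → t ≤ i → f t * g (i ∸ t) ≈ 0#
    term-zero t t≤i with j ℕP.<? t
    ... | yes j<t = trans (*-congʳ (Df t j<t)) (zeroˡ _)
    ... | no j≮t = trans (*-congˡ (Dg (i ∸ t) k<i∸t)) (zeroʳ _)
      where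
      k<i∸t : k < i ∸ t
      k<i∸t = ℕP.m+n≤o⇒m≤o∸n (suc k) (ℕP.≤-trans (ℕP.+-monoʳ-≤ (suc k) (ℕP.≮⇒≥ j≮t))
                (PE.subst (λ s → suc s ≤ i) (ℕP.+-comm j k) j+k<i))

  deg-oneF : Deg 0 oneF
  deg-oneF (suc i) _ = refl

  deg-lin : ∀ u v → Deg 1 (lin u v)
  deg-lin u v (suc zero) (s≤s ())
  deg-lin u v (suc (suc i)) _ = refl

  deg-^F : ∀ {L} → Deg 1 L → ∀ k → Deg k (L ^F k)
  deg-^F DL zero = deg-oneF
  deg-^F DL (suc k) = deg-⊗ 1 k DL (deg-^F DL k)

  deg-· : ∀ {k f} s → Deg k f → Deg k (s · f)
  deg-· s Df i k<i = trans (*-congˡ (Df i k<i)) (zeroʳ s)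

  deg-⊕ : ∀ {k f g} → Deg k f → Deg k g → Deg k (f ⊕ g)
  deg-⊕ Df Dg i k<i = trans (+-cong (Df i k<i) (Dg i k<i)) (+-identityʳ 0#)

  deg-⊖ : ∀ {k f g} → Deg k f → Deg k g → Deg k (f ⊖ g)
  deg-⊖ Df Dg i k<i = trans (+-cong (Df i k<i) (trans (-‿cong (Dg i k<i)) -0#≈0#)) (+-identityʳ 0#)

  deg-substF : ∀ k f {L₁ L₂} → Deg 1 L₁ → Deg 1 L₂ → Deg k (substF k f L₁ L₂)
  deg-substF k f {L₁} {L₂} D₁ D₂ i k<i = sumTo-zero k _ term-zero
    where
    term-zero : ∀ j → j ≤ k → f j * ((L₁ ^F (k ∸ j)) ⊗ (L₂ ^F j)) i ≈ 0#
    term-zero j j≤k = trans (*-congˡ (deg-mono (ℕP.≤-reflexive (ℕP.m∸n+n≡m j≤k))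
                        (deg-⊗ (k ∸ j) j (deg-^F D₁ (k ∸ j)) (deg-^F D₂ j)) i k<i)) (zeroʳ _)

  deg-quad : ∀ l m n → Deg 2 (quad l m n)
  deg-quad l m n (suc zero) (s≤s ())
  deg-quad l m n (suc (suc zero)) (s≤s (s≤s ()))
  deg-quad l m n (suc (suc (suc i))) _ = refl

  deg-quart : ∀ a b c d e → Deg 4 (quart a b c d e)
  deg-quart a b c d e (suc zero) (s≤s ())
  deg-quart a b c d e (suc (suc zero)) (s≤s (s≤s ()))
  deg-quart a b c d e (suc (suc (suc zero))) (s≤s (s≤s (s≤s ())))
  deg-quart a b c d e (suc (suc (suc (suc zero)))) (s≤s (s≤s (s≤s (s≤s ()))))
  deg-quart a b c d e (suc (suc (suc (suc (suc i))))) _ = refl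

  deg-G₂ : ∀ p q → Deg 4 (G₂ p q)
  deg-G₂ p q = deg-quart _ _ _ _ _

  deg-F₂ : ∀ {p q} → Deg 2 p → Deg 4 q → Deg 4 (F₂ p q)
  deg-F₂ Dp Dq = deg-⊕ (deg-⊗ 2 2 Dp Dp) (deg-· (# 4) Dq)

  deg-actP : ∀ μ r₀ r₁ r₂ α β γ δ p q → Deg 2 (actP μ r₀ r₁ r₂ α β γ δ p q)
  deg-actP μ r₀ r₁ r₂ α β γ δ p q =
    deg-substF 2 (μ · (p ⊕ ((# 2) · quad r₀ r₁ r₂))) (deg-lin α γ) (deg-lin β δ)

  deg-actQ : ∀ μ r₀ r₁ r₂ α β γ δ p q → Deg 4 (actQ μ r₀ r₁ r₂ α β γ δ p q)
  deg-actQ μ r₀ r₁ r₂ α β γ δ p q =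
    deg-substF 4 ((μ * μ) · ((q ⊖ (p ⊗ r)) ⊖ (r ⊗ r))) (deg-lin α γ) (deg-lin β δ)
    where
    r : Form
    r = quad r₀ r₁ r₂

-- The forms occurring in Lemma 3.2, defined uniformly over any commutative
-- ring: over R they are the forms of the statement, over the expression ring
-- (with variables for l, …, e) they are their generic symbolic versions.
module GeneralisedQuartic {c ℓ : Level} (S : CommutativeRing c ℓ)
                          (l m n a b c' d e : CommutativeRing.Carrier S) where
  open CommutativeRing S
  open Forms S

  p q : Form
  p = quad l m n
  q = quart a b c' d e

  module Shift (μ r₀ r₁ r₂ : Carrier) where
    p′ q′ F₂′ G₂′ F₂′-formula G₂′-formula : Form
    p′ = actP μ r₀ r₁ r₂ 1# 0# 0# 1# p q
    q′ = actQ μ r₀ r₁ r₂ 1# 0# 0# 1# p q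
    F₂′ = F₂ p′ q′
    G₂′ = G₂ p′ q′
    F₂′-formula = (μ * μ) · F₂ p q
    G₂′-formula = (μ * μ * μ * μ) · (G₂ p q ⊕ ((l * r₂ + # 2 * r₀ * r₂ + n * r₀) · F₂ p q))

  module Substitution (α β γ δ : Carrier) where
    p′ q′ F₂′ G₂′ F₂′-formula G₂′-formula : Form
    p′ = actP 1# 0# 0# 0# α β γ δ p q
    q′ = actQ 1# 0# 0# 0# α β γ δ p q
    F₂′ = F₂ p′ q′
    G₂′ = G₂ p′ q′
    Δ λ′ : Carrier
    Δ = α * δ - β * γ
    λ′ = # 2 * α * α * γ * γ * a + α * γ * (α * δ + β * γ) * b
         + # 2 * α * β * γ * δ * c' + β * δ * (α * δ + β * γ) * d
         + # 2 * β * β * δ * δ * e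
    F₂′-formula = substF 4 (F₂ p q) (lin α γ) (lin β δ)
    G₂′-formula = ((Δ * Δ) · substF 4 (G₂ p q) (lin α γ) (lin β δ))
                  ⊖ (λ′ · substF 4 (F₂ p q) (lin α γ) (lin β δ))

-- The four identities of Lemma 3.2.  Each is reduced to its five coefficients
-- by ≋-of-quartics, and the coefficient identities are proved by the solver:
-- the i-th coefficient over R is the evaluation at ρ of the i-th coefficient
-- of the generic quartic over the expression ring.
module TransformationFormulae {c ℓ : Level} (R : CommutativeRing c ℓ)
                              (l m n a b c' d e : CommutativeRing.Carrier R) where
  open CommutativeRing R
  open Forms R using (F₂; G₂; #_; _≋_; substF; lin)
  open Degree R
  open Expressions R 12 using (expressionRing; var; prove)
  open GeneralisedQuartic R l m n a b c' d e
  private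
    module Generic = GeneralisedQuartic expressionRing (var (Fin.# 0)) (var (Fin.# 1)) (var (Fin.# 2))
                       (var (Fin.# 3)) (var (Fin.# 4)) (var (Fin.# 5)) (var (Fin.# 6)) (var (Fin.# 7))
    DF₂ : Deg 4 (F₂ p q)
    DF₂ = deg-F₂ (deg-quad l m n) (deg-quart a b c' d e)

  module _ (μ r₀ r₁ r₂ : Carrier) where
    open Shift μ r₀ r₁ r₂
    private
      module X = Generic.Shift (var (Fin.# 8)) (var (Fin.# 9)) (var (Fin.# 10)) (var (Fin.# 11))
      ρ : Vec Carrier 12
      ρ = l ∷ m ∷ n ∷ a ∷ b ∷ c' ∷ d ∷ e ∷ μ ∷ r₀ ∷ r₁ ∷ r₂ ∷ []
      Dp′ : Deg 2 p′
      Dp′ = deg-actP μ r₀ r₁ r₂ 1# 0# 0# 1# p q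
      Dq′ : Deg 4 q′
      Dq′ = deg-actQ μ r₀ r₁ r₂ 1# 0# 0# 1# p q

    shift-F₂ : F₂′ ≋ F₂′-formula
    shift-F₂ = ≋-of-quartics (deg-F₂ Dp′ Dq′) (deg-· (μ * μ) DF₂)
      (prove ρ (X.F₂′ 0) (X.F₂′-formula 0) refl) (prove ρ (X.F₂′ 1) (X.F₂′-formula 1) refl)
      (prove ρ (X.F₂′ 2) (X.F₂′-formula 2) refl) (prove ρ (X.F₂′ 3) (X.F₂′-formula 3) refl)
      (prove ρ (X.F₂′ 4) (X.F₂′-formula 4) refl)

    shift-G₂ : G₂′ ≋ G₂′-formula
    shift-G₂ = ≋-of-quartics (deg-G₂ p′ q′)
      (deg-· (μ * μ * μ * μ) (deg-⊕ (deg-G₂ p q) (deg-· (l * r₂ + # 2 * r₀ * r₂ + n * r₀) DF₂)))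
      (prove ρ (X.G₂′ 0) (X.G₂′-formula 0) refl) (prove ρ (X.G₂′ 1) (X.G₂′-formula 1) refl)
      (prove ρ (X.G₂′ 2) (X.G₂′-formula 2) refl) (prove ρ (X.G₂′ 3) (X.G₂′-formula 3) refl)
      (prove ρ (X.G₂′ 4) (X.G₂′-formula 4) refl)

  module _ (α β γ δ : Carrier) where
    open Substitution α β γ δ
    private
      module X = Generic.Substitution (var (Fin.# 8)) (var (Fin.# 9)) (var (Fin.# 10)) (var (Fin.# 11))
      ρ : Vec Carrier 12
      ρ = l ∷ m ∷ n ∷ a ∷ b ∷ c' ∷ d ∷ e ∷ α ∷ β ∷ γ ∷ δ ∷ []
      Dp′ : Deg 2 p′
      Dp′ = deg-actP 1# 0# 0# 0# α β γ δ p q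
      Dq′ : Deg 4 q′
      Dq′ = deg-actQ 1# 0# 0# 0# α β γ δ p q
      Dsubst : ∀ f → Deg 4 (substF 4 f (lin α γ) (lin β δ))
      Dsubst f = deg-substF 4 f (deg-lin α γ) (deg-lin β δ)

    substitution-F₂ : F₂′ ≋ F₂′-formula
    substitution-F₂ = ≋-of-quartics (deg-F₂ Dp′ Dq′) (Dsubst (F₂ p q))
      (prove ρ (X.F₂′ 0) (X.F₂′-formula 0) refl) (prove ρ (X.F₂′ 1) (X.F₂′-formula 1) refl)
      (prove ρ (X.F₂′ 2) (X.F₂′-formula 2) refl) (prove ρ (X.F₂′ 3) (X.F₂′-formula 3) refl)
      (prove ρ (X.F₂′ 4) (X.F₂′-formula 4) refl)

    substitution-G₂ : G₂′ ≋ G₂′-formula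
    substitution-G₂ = ≋-of-quartics (deg-G₂ p′ q′)
      (deg-⊖ (deg-· (Δ * Δ) (Dsubst (G₂ p q))) (deg-· λ′ (Dsubst (F₂ p q))))
      (prove ρ (X.G₂′ 0) (X.G₂′-formula 0) refl) (prove ρ (X.G₂′ 1) (X.G₂′-formula 1) refl)
      (prove ρ (X.G₂′ 2) (X.G₂′-formula 2) refl) (prove ρ (X.G₂′ 3) (X.G₂′-formula 3) refl)
      (prove ρ (X.G₂′ 4) (X.G₂′-formula 4) refl)

-- Lemma 3.2.
lemma3p2 : ∀ {c ℓ : Level} (R : CommutativeRing c ℓ) →
  let open CommutativeRing R
      open Forms R
  in ∀ (l m n a b c' d e : Carrier) →
     let p = quad l m n
         q = quart a b c' d e
     in (∀ (μ r₀ r₁ r₂ : Carrier) → IsUnit μ →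
          let p' = actP μ r₀ r₁ r₂ 1# 0# 0# 1# p q
              q' = actQ μ r₀ r₁ r₂ 1# 0# 0# 1# p q
          in (F₂ p' q' ≋ ((μ * μ) · F₂ p q))
             × (G₂ p' q' ≋ ((μ * μ * μ * μ) ·
                  (G₂ p q ⊕ ((l * r₂ + # 2 * r₀ * r₂ + n * r₀) · F₂ p q)))))
      × (∀ (α β γ δ : Carrier) → IsInvertible2 α β γ δ →
          let p' = actP 1# 0# 0# 0# α β γ δ p q
              q' = actQ 1# 0# 0# 0# α β γ δ p q
              Δ = α * δ - β * γ
              λ' = # 2 * α * α * γ * γ * a + α * γ * (α * δ + β * γ) * b
                   + # 2 * α * β * γ * δ * c' + β * δ * (α * δ + β * γ) * d
                   + # 2 * β * β * δ * δ * e
          in (F₂ p' q' ≋ substF 4 (F₂ p q) (lin α γ) (lin β δ))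
             × (G₂ p' q' ≋ (((Δ * Δ) · substF 4 (G₂ p q) (lin α γ) (lin β δ))
                            ⊖ (λ' · substF 4 (F₂ p q) (lin α γ) (lin β δ)))))
lemma3p2 R l m n a b c' d e =
  (λ μ r₀ r₁ r₂ _ → shift-F₂ μ r₀ r₁ r₂ , shift-G₂ μ r₀ r₁ r₂) ,
  (λ α β γ δ _ → substitution-F₂ α β γ δ , substitution-G₂ α β γ δ)
  where open TransformationFormulae R l m n a b c' d e
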